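{- Let $\lambda$ and $\mu$ be strict partitions with $\mu\subseteq\lambda$ such that the image of $SF^{\lambda/\mu}$ under anti-diagonal reflection is $SF^{\kappa/\nu}$ ($\kappa,\nu$ strict partitions), and let $\mathrm{X}=(x_{kc})$, $\mathrm{Y}=(y_{kc})$, $\widetilde{\mathrm{X}}=(x_{n-k+1,c})$, $\widetilde{\mathrm{Y}}=(y_{n-k+1,c})$ with $k=1,\ldots,n$ and $c\in\mathbb{Z}$. Then $$Q_{\lambda/\mu}(\mathrm{X},\mathrm{Y})=Q_{\kappa/\nu}(\widetilde{\mathrm{Y}},\widetilde{\mathrm{X}}).$$
   Context: For a strict partition $\lambda=(\lambda_1>\cdots>\lambda_\ell>0)$, $SF^\lambda=\{(i,j):1\le i\le\ell,\ i\le j\le\lambda_i+i-1\}$, box $(i,j)$ of content $j-i$; $SF^{\lambda/\mu}=SF^\lambda\setminus SF^\mu$. The anti-diagonal reflection of $SF^{\lambda/\mu}$ is its reflection in the SW-to-NE anti-diagonal through the box $(1,\lambda_1)$, i.e. $(i,j)\mapsto(\lambda_1-j+1,\lambda_1-i+1)$. A primed shifted tableau of shape $\lambda/\mu$ fills $SF^{\lambda/\mu}$ with entries from $\{1'<1<\cdots<n'<n\}$, weakly increasing along rows and down columns, no unprimed $k$ repeated in a column, no primed $k'$ repeated in a row. For families $\mathrm{U}=(u_{kc})$, $\mathrm{V}=(v_{kc})$ of commuting indeterminates, $Q_{\lambda/\mu}(\mathrm{U},\mathrm{V})=\sum_T\prod\mathrm{wgt}(t_{ij})$ with $\mathrm{wgt}(t_{ij})=u_{k,j-i}$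 if $t_{ij}=k$ and $v_{k,j-i}$ if $t_{ij}=k'$. -}

module Defs where

open import Level using (Level)
open import Data.Nat using (ℕ; zero; suc; _+_; _*_; _∸_; _≤_; _<_; _>_; _≤?_; _<?_)
import Data.Nat as ℕ
open import Data.Integer using (ℤ; _⊖_)
open import Data.Fin using (Fin; opposite)
import Data.Fin as Fin
open import Data.List using (List; []; _∷_; length; map; filter; zip; allFin; applyUpTo; concatMap; _++_; foldr)
open import Data.Nat.ListAction using (sum)
open import Data.List.Relation.Unary.All using (All; all?)
open import Data.List.Relation.Unary.Linked using (Linked)
open import Data.Product using (_×_; _,_; ∃; ∃-syntax; Σ)
open import Relation.Nullary using (Dec; yes; no; ¬_)
open import Relation.Nullary.Decidable using (_×-dec_; _→-dec_; ¬?)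
open import Relation.Binary.PropositionalEquality using (_≡_; refl; cong)
open import Algebra.Bundles using (CommutativeSemiring)

StrictPartition : List ℕ → Set
StrictPartition la = Linked _>_ la × All (0 <_) la

-- 1-indexed part λ_i (0 when i = 0 or i > ℓ(λ))
part : List ℕ → ℕ → ℕ
part []       _             = 0
part (x ∷ xs) zero          = 0
part (x ∷ xs) (suc zero)    = x
part (x ∷ xs) (suc (suc i)) = part xs (suc i)

firstPart : List ℕ → ℕ
firstPart la = part la 1

_⊆ₚ_ : List ℕ → List ℕ → Set
mu ⊆ₚ la = ∀ i → part mu i ≤ part la i

-- Shifted diagrams.  Boxes are pairs (i , j) = (row , column), 1-indexed.

Box : Set
Box = ℕ × ℕ

InSF : List ℕ → ℕ → ℕ → Set
InSF la i j = (1 ≤ i) × (i ≤ length la) × (i ≤ j) × (j < part la i + i)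

inSF? : ∀ la i j → Dec (InSF la i j)
inSF? la i j = (1 ≤? i) ×-dec ((i ≤? length la) ×-dec ((i ≤? j) ×-dec (j <? part la i + i)))

InSkew : List ℕ → List ℕ → ℕ → ℕ → Set
InSkew la mu i j = InSF la i j × ¬ InSF mu i j

inSkew? : ∀ la mu i j → Dec (InSkew la mu i j)
inSkew? la mu i j = inSF? la i j ×-dec ¬? (inSF? mu i j)

-- anti-diagonal reflection through the box (1 , λ₁):
-- (i , j) ↦ (λ₁ - j + 1 , λ₁ - i + 1)
reflect : List ℕ → Box → Box
reflect la (i , j) = (firstPart la ∸ j + 1 , firstPart la ∸ i + 1)

InReflImage : List ℕ → List ℕ → ℕ → ℕ → Set
InReflImage la mu i j =
  ∃[ i' ] ∃[ j' ] (InSkew la mu i' j' × reflect la (i' , j') ≡ (i , j))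

-- all boxes of SF^{λ/μ}, listed (without repetition) by scanning the
-- rectangle [1,B]×[1,B] with B = ℓ(λ) + |λ|, which contains SF^λ.
skewBoxes : List ℕ → List ℕ → List Box
skewBoxes la mu =
  filter (λ b → inSkew? la mu (Data.Product.proj₁ b) (Data.Product.proj₂ b))
    (concatMap (λ i → map (λ j → (i , j)) range) range)
  where
  B = length la + sum la
  range = applyUpTo suc B

content : Box → ℤ
content (i , j) = j ⊖ i

-- The primed alphabet 1' < 1 < 2' < 2 < ⋯ < n' < n  (letters indexed by Fin n)

data Letter (n : ℕ) : Set where
  primed   : Fin n → Letter n
  unprimed : Fin n → Letter n

rank : ∀ {n} → Letter n → ℕ
rank (primed k)   = 2 * Fin.toℕ k
rank (unprimed k) = 2 * Fin.toℕ k + 1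

_≤L_ : ∀ {n} → Letter n → Letter n → Set
a ≤L b = rank a ≤ rank b

_≟L_ : ∀ {n} (a b : Letter n) → Dec (a ≡ b)
primed k   ≟L primed l   with k Fin.≟ l
... | yes refl = yes refl
... | no k≢l   = no λ { refl → k≢l refl }
primed k   ≟L unprimed l = no λ ()
unprimed k ≟L primed l   = no λ ()
unprimed k ≟L unprimed l with k Fin.≟ l
... | yes refl = yes refl
... | no k≢l   = no λ { refl → k≢l refl }

IsPrimed : ∀ {n} → Letter n → Set
IsPrimed a = ∃[ k ] (a ≡ primed k)

IsUnprimed : ∀ {n} → Letter n → Set
IsUnprimed a = ∃[ k ] (a ≡ unprimed k)

isPrimed? : ∀ {n} (a : Letter n) → Dec (IsPrimed a)
isPrimed? (primed k)   = yes (k , refl)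
isPrimed? (unprimed k) = no λ { (_ , ()) }

isUnprimed? : ∀ {n} (a : Letter n) → Dec (IsUnprimed a)
isUnprimed? (primed k)   = no λ { (_ , ()) }
isUnprimed? (unprimed k) = yes (k , refl)

allLetters : (n : ℕ) → List (Letter n)
allLetters n = map primed (allFin n) ++ map unprimed (allFin n)

words : (n m : ℕ) → List (List (Letter n))
words n zero    = [] ∷ []
words n (suc m) = concatMap (λ a → map (a ∷_) (words n m)) (allLetters n)

RowOK : ∀ {n} → Box × Letter n → Box × Letter n → Set
RowOK ((i , j) , a) ((i' , j') , b) =
  i ≡ i' → j < j' → (a ≤L b) × (a ≡ b → ¬ IsPrimed a)

ColOK : ∀ {n} → Box × Letter n → Box × Letter n → Set
ColOK ((i , j) , a) ((i' , j') , b) =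
  j ≡ j' → i < i' → (a ≤L b) × (a ≡ b → ¬ IsUnprimed a)

rowOK? : ∀ {n} p q → Dec (RowOK {n} p q)
rowOK? ((i , j) , a) ((i' , j') , b) =
  (i ℕ.≟ i') →-dec ((j <? j') →-dec
    ((rank a ≤? rank b) ×-dec ((a ≟L b) →-dec ¬? (isPrimed? a))))

colOK? : ∀ {n} p q → Dec (ColOK {n} p q)
colOK? ((i , j) , a) ((i' , j') , b) =
  (j ℕ.≟ j') →-dec ((i <? i') →-dec
    ((rank a ≤? rank b) ×-dec ((a ≟L b) →-dec ¬? (isUnprimed? a))))

IsTableau : ∀ {n} → List (Box × Letter n) → Set
IsTableau ps = All (λ p → All (λ q → RowOK p q × ColOK p q) ps) ps

isTableau? : ∀ {n} (ps : List (Box × Letter n)) → Dec (IsTableau ps)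
isTableau? ps = all? (λ p → all? (λ q → rowOK? p q ×-dec colOK? p q) ps) ps

-- Q_{λ/μ}(U, V) evaluated in a commutative semiring R, where the
-- indeterminates u_{kc}, v_{kc} (k ∈ Fin n, c ∈ ℤ) are given values
-- U k c, V k c.  (A polynomial identity with ℕ coefficients holds iff it
-- holds under every evaluation in every commutative semiring.)

module _ {c ℓ : Level} (R : CommutativeSemiring c ℓ) where
  open CommutativeSemiring R using (Carrier) renaming (_+_ to _+R_; _*_ to _*R_; 0# to 0R; 1# to 1R)

  wgt : ∀ {n} → (Fin n → ℤ → Carrier) → (Fin n → ℤ → Carrier) →
        Box × Letter n → Carrier
  wgt U V (b , unprimed k) = U k (content b)
  wgt U V (b , primed k)   = V k (content b)

  tableaux : (n : ℕ) → List ℕ → List ℕ → List (List (Box × Letter n))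
  tableaux n la mu =
    filter isTableau?
      (map (zip (skewBoxes la mu)) (words n (length (skewBoxes la mu))))

  Q : (n : ℕ) → List ℕ → List ℕ →
      (Fin n → ℤ → Carrier) → (Fin n → ℤ → Carrier) → Carrier
  Q n la mu U V =
    foldr _+R_ 0R
      (map (λ T → foldr _*R_ 1R (map (wgt U V) T)) (tableaux n la mu))

reverseRows : ∀ {a} {A : Set a} {n : ℕ} → (Fin n → ℤ → A) → (Fin n → ℤ → A)
reverseRows X k c = X (opposite k) c

module Submission where

-- Write Q_{λ/μ}(X,Y) as a sum, over ALL words w of length |λ/μ|, of
-- [zip boxes w is a tableau] · ∏ wgt, where "boxes" enumerates SF^{λ/μ}.
-- The involution Ψ (b , a) = (ρ b , φ a), with ρ the anti-diagonal
-- reflection of boxes and φ the letter involution k ↦ (n+1-k)', k' ↦ n+1-k,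
-- maps the filling T to a filling of the reflected shape such that
--   * rows of Ψ T are the reversed columns of T and vice versa, and φ
--     reverses the order 1' < 1 < ⋯ < n' < n while swapping primes, so
--     Ψ T is a tableau iff T is (tableau-Ψ);
--   * ρ preserves contents, so wgt_{X,Y} p = wgt_{Ỹ,X̃} (Ψ p) (wgt-Ψ).
-- Since φ permutes the alphabet, summing over w or over map φ w gives the
-- same result (Σ-words-map); since the reflected box list is a permutation
-- of the box list of κ/ν (reflect-skewBoxes) and the summand only depends
-- on the filling up to permutation, the box order is irrelevant (ΣFillings-↭).

open import Defs
open import Level using (Level)
open import Data.Nat using (ℕ; zero; suc; _∸_; _≤_; _<_; _>_; z≤n; s≤s)
import Data.Nat.Properties as ℕₚ
open import Data.Nat.ListAction using (sum)
open import Data.Nat.Solver using (module +-*-Solver)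
open import Data.Integer using (ℤ; _⊖_)
import Data.Integer.Properties as ℤ
open import Data.Fin using (Fin; opposite; toℕ)
open import Data.Fin.Properties using (opposite-involutive; opposite-prop; toℕ<n)
open import Data.List using (List; []; _∷_; length; map; filter; zip; foldr; allFin; concatMap; _++_; applyUpTo; cartesianProduct)
open import Data.List.Properties using (length-map; map-++; map-∘)
open import Data.List.Membership.Propositional using (_∈_)
open import Data.List.Membership.Propositional.Properties
  using (∈-map⁺; ∈-map⁻; ∈-allFin; ∈-∃++; ∈-filter⁺; ∈-filter⁻; ∈-cartesianProduct⁺; ∈-applyUpTo⁺)
open import Data.List.Relation.Unary.All as All using (All; []; _∷_)
import Data.List.Relation.Unary.All.Properties as All
open import Data.List.Relation.Unary.AllPairs as AllPairs using (_∷_; [])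
open import Data.List.Relation.Unary.Any using (here; there)
open import Data.List.Relation.Unary.Linked using (Linked; _∷_)
open import Data.List.Relation.Unary.Unique.Propositional using (Unique)
import Data.List.Relation.Unary.Unique.Propositional.Properties as Unique
open import Data.List.Relation.Binary.Permutation.Propositional as Perm using (_↭_; ↭⇒↭ₛ; ↭⇒↭ₛ′)
import Data.List.Relation.Binary.Permutation.Propositional.Properties as Perm
import Data.List.Relation.Binary.Permutation.Setoid.Properties as PermSetoid
open import Data.Product using (_×_; _,_; proj₁; proj₂)
open import Data.Empty using (⊥-elim)
open import Relation.Nullary using (Dec; yes; no)
open import Relation.Binary.PropositionalEquality as ≡ using (_≡_; cong; cong₂; subst; subst₂)
open import Function using (_∘_)
open import Function.Bundles using (_⇔_; mk⇔; Equivalence)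
open import Algebra.Bundles using (CommutativeSemiring)

module ListSums {c ℓ : Level} (R : CommutativeSemiring c ℓ) where
  open CommutativeSemiring R
  open import Relation.Binary.Reasoning.Setoid setoid

  Σ : ∀ {a} {A : Set a} → List A → (A → Carrier) → Carrier
  Σ L f = foldr _+_ 0# (map f L)

  Σ-cong : ∀ {a} {A : Set a} (L : List A) {f g : A → Carrier} →
           (∀ x → f x ≈ g x) → Σ L f ≈ Σ L g
  Σ-cong []      f≈g = refl
  Σ-cong (x ∷ L) f≈g = +-cong (f≈g x) (Σ-cong L f≈g)

  Σ-++ : ∀ {a} {A : Set a} (L M : List A) (f : A → Carrier) →
         Σ (L ++ M) f ≈ Σ L f + Σ M f
  Σ-++ []      M f = sym (+-identityˡ _)
  Σ-++ (x ∷ L) M f = trans (+-congˡ (Σ-++ L M f)) (sym (+-assoc _ _ _))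

  Σ-map : ∀ {a b} {A : Set a} {B : Set b} (L : List A) (g : A → B) (f : B → Carrier) →
          Σ (map g L) f ≈ Σ L (f ∘ g)
  Σ-map []      g f = refl
  Σ-map (x ∷ L) g f = +-congˡ (Σ-map L g f)

  Σ-concatMap : ∀ {a b} {A : Set a} {B : Set b} (L : List A) (h : A → List B) (f : B → Carrier) →
                Σ (concatMap h L) f ≈ Σ L (λ x → Σ (h x) f)
  Σ-concatMap []      h f = refl
  Σ-concatMap (x ∷ L) h f = trans (Σ-++ (h x) (concatMap h L) f) (+-congˡ (Σ-concatMap L h f))

  Σ-0 : ∀ {a} {A : Set a} (L : List A) → Σ L (λ _ → 0#) ≈ 0#
  Σ-0 []      = refl
  Σ-0 (x ∷ L) = trans (+-identityˡ _) (Σ-0 L)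

  Σ-+ : ∀ {a} {A : Set a} (L : List A) (f g : A → Carrier) →
        Σ L (λ x → f x + g x) ≈ Σ L f + Σ L g
  Σ-+ []      f g = sym (+-identityˡ _)
  Σ-+ (x ∷ L) f g = begin
    (f x + g x) + Σ L (λ x → f x + g x) ≈⟨ +-congˡ (Σ-+ L f g) ⟩
    (f x + g x) + (Σ L f + Σ L g)       ≈⟨ +-assoc _ _ _ ⟩
    f x + (g x + (Σ L f + Σ L g))       ≈⟨ +-congˡ (sym (+-assoc _ _ _)) ⟩
    f x + ((g x + Σ L f) + Σ L g)       ≈⟨ +-congˡ (+-congʳ (+-comm _ _)) ⟩
    f x + ((Σ L f + g x) + Σ L g)       ≈⟨ +-congˡ (+-assoc _ _ _) ⟩
    f x + (Σ L f + (g x + Σ L g))       ≈⟨ sym (+-assoc _ _ _) ⟩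
    (f x + Σ L f) + (g x + Σ L g)       ∎

  Σ-swap : ∀ {a b} {A : Set a} {B : Set b} (L : List A) (M : List B) (f : A → B → Carrier) →
           Σ L (λ x → Σ M (f x)) ≈ Σ M (λ y → Σ L (λ x → f x y))
  Σ-swap []      M f = sym (Σ-0 M)
  Σ-swap (x ∷ L) M f =
    trans (+-congˡ (Σ-swap L M f)) (sym (Σ-+ M (f x) (λ y → Σ L (λ x → f x y))))

  Σ-perm : ∀ {a} {A : Set a} {L M : List A} (f : A → Carrier) → L ↭ M → Σ L f ≈ Σ M f
  Σ-perm f L↭M = PermSetoid.foldr-commMonoid setoid +-isCommutativeMonoid
                   (↭⇒↭ₛ′ isEquivalence (Perm.map⁺ f L↭M))

  indicator : ∀ {p} {P : Set p} → Dec P → Carrier → Carrier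
  indicator (yes _) x = x
  indicator (no _)  x = 0#

  indicator-cong : ∀ {p q} {P : Set p} {Q : Set q} (P? : Dec P) (Q? : Dec Q) →
                   P ⇔ Q → ∀ {x y} → x ≈ y → indicator P? x ≈ indicator Q? y
  indicator-cong (yes _) (yes _) P⇔Q x≈y = x≈y
  indicator-cong (yes p) (no ¬q) P⇔Q x≈y = ⊥-elim (¬q (Equivalence.to P⇔Q p))
  indicator-cong (no ¬p) (yes q) P⇔Q x≈y = ⊥-elim (¬p (Equivalence.from P⇔Q q))
  indicator-cong (no _)  (no _)  P⇔Q x≈y = refl

  Σ-filter : ∀ {a p} {A : Set a} {P : A → Set p} (P? : ∀ x → Dec (P x)) (L : List A) (f : A → Carrier) →
             Σ (filter P? L) f ≈ Σ L (λ x → indicator (P? x) (f x))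
  Σ-filter P? []      f = refl
  Σ-filter P? (x ∷ L) f with P? x
  ... | yes _ = +-congˡ (Σ-filter P? L f)
  ... | no _  = trans (Σ-filter P? L f) (sym (+-identityˡ _))

-- This turns "the reflection is a bijection SF^{λ/μ} → SF^{κ/ν}"
-- and "opposite is a bijection of Fin n" into permutations of lists.
Unique-sameMembers⇒↭ : ∀ {a} {A : Set a} {xs ys : List A} → Unique xs → Unique ys →
                       (∀ {z} → z ∈ xs → z ∈ ys) → (∀ {z} → z ∈ ys → z ∈ xs) → xs ↭ ys
Unique-sameMembers⇒↭ {xs = []}    {[]}    _ _ _ _ = Perm.refl
Unique-sameMembers⇒↭ {xs = []}    {y ∷ _} _ _ _ ys⊆xs with ys⊆xs (here ≡.refl)
... | ()
Unique-sameMembers⇒↭ {A = A} {xs = x ∷ xs} (x∉xs ∷ xs!) ys! xs⊆ys ys⊆xs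
  with ∈-∃++ (xs⊆ys (here ≡.refl))
... | h , t , ≡.refl =
  Perm.trans (Perm.prep x (Unique-sameMembers⇒↭ xs! ht! xs⊆ht ht⊆xs)) (Perm.↭-sym x-front)
  where
  x-front : h ++ x ∷ t ↭ x ∷ (h ++ t)
  x-front = Perm.shift x h t
  x∷ht! : Unique (x ∷ (h ++ t))
  x∷ht! = PermSetoid.Unique-resp-↭ (≡.setoid A) (↭⇒↭ₛ x-front) ys!
  ht! : Unique (h ++ t)
  ht! = AllPairs.tail x∷ht!
  xs⊆ht : ∀ {z} → z ∈ xs → z ∈ h ++ t
  xs⊆ht z∈xs with Perm.∈-resp-↭ x-front (xs⊆ys (there z∈xs))
  ... | here ≡.refl = ⊥-elim (All.lookup x∉xs z∈xs ≡.refl)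
  ... | there z∈ht  = z∈ht
  ht⊆xs : ∀ {z} → z ∈ h ++ t → z ∈ xs
  ht⊆xs z∈ht with ys⊆xs (Perm.∈-resp-↭ (Perm.↭-sym x-front) (there z∈ht))
  ... | here ≡.refl = ⊥-elim (All.lookup (AllPairs.head x∷ht!) z∈ht ≡.refl)
  ... | there z∈xs  = z∈xs

Unique-map-injectiveOn : ∀ {a b p} {A : Set a} {B : Set b} {P : A → Set p} {f : A → B} {xs : List A} →
  All P xs → (∀ {x y} → P x → P y → f x ≡ f y → x ≡ y) → Unique xs → Unique (map f xs)
Unique-map-injectiveOn []         inj []            = []
Unique-map-injectiveOn (px ∷ pxs) inj (x∉xs ∷ xs!) =
  All.map⁺ (All.tabulate (λ y∈xs fx≡fy → All.lookup x∉xs y∈xs (inj px (All.lookup pxs y∈xs) fx≡fy)))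
  ∷ Unique-map-injectiveOn pxs inj xs!

φ : ∀ {n} → Letter n → Letter n
φ (primed k)   = unprimed (opposite k)
φ (unprimed k) = primed (opposite k)

φ-involutive : ∀ {n} (a : Letter n) → φ (φ a) ≡ a
φ-involutive (primed k)   = cong primed (opposite-involutive k)
φ-involutive (unprimed k) = cong unprimed (opposite-involutive k)

φ-injective : ∀ {n} {a b : Letter n} → φ a ≡ φ b → a ≡ b
φ-injective {a = a} {b} φa≡φb =
  ≡.trans (≡.sym (φ-involutive a)) (≡.trans (cong φ φa≡φb) (φ-involutive b))

primed-φ : ∀ {n} (a : Letter n) → IsPrimed (φ a) ⇔ IsUnprimed a
primed-φ (primed k)   = mk⇔ (λ { (_ , ()) }) (λ { (_ , ()) })
primed-φ (unprimed k) = mk⇔ (λ _ → k , ≡.refl) (λ _ → opposite k , ≡.refl)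

unprimed-φ : ∀ {n} (a : Letter n) → IsUnprimed (φ a) ⇔ IsPrimed a
unprimed-φ (primed k)   = mk⇔ (λ _ → k , ≡.refl) (λ _ → opposite k , ≡.refl)
unprimed-φ (unprimed k) = mk⇔ (λ { (_ , ()) }) (λ { (_ , ()) })

module LetterRank where
  open import Data.Nat using (_+_; _*_)
  open +-*-Solver

  private
    opposite+1+k : ∀ {n} (k : Fin n) → toℕ (opposite k) + suc (toℕ k) ≡ n
    opposite+1+k k = ≡.trans (cong (_+ suc (toℕ k)) (opposite-prop k)) (ℕₚ.m∸n+n≡m (toℕ<n k))

  rank-φ+rank : ∀ {n} (a : Letter n) → rank (φ a) + suc (rank a) ≡ 2 * n
  rank-φ+rank (primed k) = ≡.trans (arith (toℕ (opposite k)) (toℕ k)) (cong (2 *_) (opposite+1+k k))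
    where
    arith : ∀ t k → 2 * t + 1 + suc (2 * k) ≡ 2 * (t + suc k)
    arith = solve 2 (λ t k → con 2 :* t :+ con 1 :+ (con 1 :+ con 2 :* k) := con 2 :* (t :+ (con 1 :+ k))) ≡.refl
  rank-φ+rank (unprimed k) = ≡.trans (arith (toℕ (opposite k)) (toℕ k)) (cong (2 *_) (opposite+1+k k))
    where
    arith : ∀ t k → 2 * t + suc (2 * k + 1) ≡ 2 * (t + suc k)
    arith = solve 2 (λ t k → con 2 :* t :+ (con 1 :+ (con 2 :* k :+ con 1)) := con 2 :* (t :+ (con 1 :+ k))) ≡.refl

  rank-φ : ∀ {n} (a : Letter n) → rank (φ a) ≡ 2 * n ∸ suc (rank a)
  rank-φ a = ≡.trans (≡.sym (ℕₚ.m+n∸n≡m (rank (φ a)) (suc (rank a))))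
                     (cong (_∸ suc (rank a)) (rank-φ+rank a))

  φ-antitone : ∀ {n} {a b : Letter n} → b ≤L a → φ a ≤L φ b
  φ-antitone {n} {a} {b} b≤a =
    subst₂ _≤_ (≡.sym (rank-φ a)) (≡.sym (rank-φ b)) (ℕₚ.∸-monoʳ-≤ (2 * n) (s≤s b≤a))

  φ-reflects-≤ : ∀ {n} {a b : Letter n} → φ a ≤L φ b → b ≤L a
  φ-reflects-≤ {a = a} {b} φa≤φb =
    subst₂ _≤L_ (φ-involutive b) (φ-involutive a) (φ-antitone {a = φ b} {b = φ a} φa≤φb)

open LetterRank using (φ-antitone; φ-reflects-≤)

opposite-↭ : ∀ n → map opposite (allFin n) ↭ allFin n
opposite-↭ n = Unique-sameMembers⇒↭
  (Unique.map⁺ opposite-injective (Unique.allFin⁺ n)) (Unique.allFin⁺ n)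
  (λ _ → ∈-allFin _)
  (λ {k} _ → subst (_∈ map opposite (allFin n)) (opposite-involutive k)
                   (∈-map⁺ opposite (∈-allFin (opposite k))))
  where
  opposite-injective : ∀ {k l : Fin n} → opposite k ≡ opposite l → k ≡ l
  opposite-injective {k} {l} e =
    ≡.trans (≡.sym (opposite-involutive k)) (≡.trans (cong opposite e) (opposite-involutive l))

φ-↭ : ∀ n → map φ (allLetters n) ↭ allLetters n
φ-↭ n = begin
  map φ (map primed A ++ map unprimed A)
    ≡⟨ map-++ φ (map primed A) (map unprimed A) ⟩
  map φ (map primed A) ++ map φ (map unprimed A)
    ≡⟨ cong₂ _++_ (≡.sym (map-∘ A)) (≡.sym (map-∘ A)) ⟩
  map (unprimed ∘ opposite) A ++ map (primed ∘ opposite) A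
    ≡⟨ cong₂ _++_ (map-∘ A) (map-∘ A) ⟩
  map unprimed (map opposite A) ++ map primed (map opposite A)
    ↭⟨ Perm.++⁺ (Perm.map⁺ unprimed (opposite-↭ n)) (Perm.map⁺ primed (opposite-↭ n)) ⟩
  map unprimed A ++ map primed A
    ↭⟨ Perm.++-comm (map unprimed A) (map primed A) ⟩
  map primed A ++ map unprimed A ∎
  where
  open Perm.PermutationReasoning
  A = allFin n

module WordSums {c ℓ : Level} (R : CommutativeSemiring c ℓ) (n : ℕ) where
  open CommutativeSemiring R
  open ListSums R
  open import Relation.Binary.Reasoning.Setoid setoid

  Σ-words-suc : ∀ m (g : List (Letter n) → Carrier) →
    Σ (words n (suc m)) g ≈ Σ (allLetters n) (λ a → Σ (words n m) (λ w → g (a ∷ w)))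
  Σ-words-suc m g = trans (Σ-concatMap (allLetters n) (λ a → map (a ∷_) (words n m)) g)
                          (Σ-cong (allLetters n) (λ a → Σ-map (words n m) (a ∷_) g))

  Σ-words-map : (f : Letter n → Letter n) → map f (allLetters n) ↭ allLetters n →
    ∀ m (g : List (Letter n) → Carrier) → Σ (words n m) (g ∘ map f) ≈ Σ (words n m) g
  Σ-words-map f f-↭ zero    g = refl
  Σ-words-map f f-↭ (suc m) g = begin
    Σ (words n (suc m)) (g ∘ map f)                         ≈⟨ Σ-words-suc m (g ∘ map f) ⟩
    Σ letters (λ a → Σ (words n m) (λ w → g (f a ∷ map f w))) ≈⟨ Σ-cong letters (λ a → Σ-words-map f f-↭ m (λ w → g (f a ∷ w))) ⟩
    Σ letters (h ∘ f)                                       ≈⟨ Σ-map letters f h ⟨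
    Σ (map f letters) h                                     ≈⟨ Σ-perm h f-↭ ⟩
    Σ letters h                                             ≈⟨ Σ-words-suc m g ⟨
    Σ (words n (suc m)) g                                   ∎
    where
    letters = allLetters n
    h : Letter n → Carrier
    h a = Σ (words n m) (λ w → g (a ∷ w))

  Filling : Set
  Filling = List (Box × Letter n)

  ΣFillings : (Filling → Carrier) → List Box → Carrier
  ΣFillings F bs = Σ (words n (length bs)) (λ w → F (zip bs w))

  PermutationInvariant : (Filling → Carrier) → Set _
  PermutationInvariant F = ∀ {T T'} → T ↭ T' → F T ≈ F T'

  ΣFillings-↭ : ∀ {bs bs'} → bs ↭ bs' → ∀ F → PermutationInvariant F → ΣFillings F bs ≈ ΣFillings F bs'
  ΣFillings-↭ Perm.refl          F inv = refl
  ΣFillings-↭ (Perm.trans p q)   F inv = trans (ΣFillings-↭ p F inv) (ΣFillings-↭ q F inv)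
  ΣFillings-↭ {x ∷ bs} {_ ∷ bs'} (Perm.prep x p) F inv = begin
    ΣFillings F (x ∷ bs)                                          ≈⟨ Σ-words-suc (length bs) _ ⟩
    Σ (allLetters n) (λ a → ΣFillings (λ T → F ((x , a) ∷ T)) bs)  ≈⟨ Σ-cong (allLetters n) (λ a →
                                                                        ΣFillings-↭ p (λ T → F ((x , a) ∷ T)) (inv ∘ Perm.prep _)) ⟩
    Σ (allLetters n) (λ a → ΣFillings (λ T → F ((x , a) ∷ T)) bs') ≈⟨ Σ-words-suc (length bs') _ ⟨
    ΣFillings F (x ∷ bs')                                         ∎
  ΣFillings-↭ {x ∷ y ∷ bs} {_ ∷ _ ∷ bs'} (Perm.swap x y p) F inv = begin
    ΣFillings F (x ∷ y ∷ bs)                    ≈⟨ Σ-words-suc (suc (length bs)) _ ⟩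
    Σ L (λ a → Σ (words n (suc (length bs))) (λ w → F (zip (x ∷ y ∷ bs) (a ∷ w))))
                                                ≈⟨ Σ-cong L (λ a → Σ-words-suc (length bs) _) ⟩
    Σ L (λ a → Σ L (λ b → ΣFillings (F₂ a b) bs)) ≈⟨ Σ-cong L (λ a → Σ-cong L (λ b →
                                                     ΣFillings-↭ p (F₂ a b) (inv ∘ Perm.prep _ ∘ Perm.prep _))) ⟩
    Σ L (λ a → Σ L (λ b → ΣFillings (F₂ a b) bs')) ≈⟨ Σ-swap L L _ ⟩
    Σ L (λ b → Σ L (λ a → ΣFillings (F₂ a b) bs')) ≈⟨ Σ-cong L (λ b → Σ-cong L (λ a → Σ-cong (words n (length bs')) (λ w →
                                                     inv (Perm.swap _ _ Perm.refl)))) ⟩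
    Σ L (λ b → Σ L (λ a → ΣFillings (λ T → F ((y , b) ∷ (x , a) ∷ T)) bs'))
                                                ≈⟨ Σ-cong L (λ b → Σ-words-suc (length bs') _) ⟨
    Σ L (λ b → Σ (words n (suc (length bs'))) (λ w → F (zip (y ∷ x ∷ bs') (b ∷ w))))
                                                ≈⟨ Σ-words-suc (suc (length bs')) _ ⟨
    ΣFillings F (y ∷ x ∷ bs')                   ∎
    where
    L = allLetters n
    F₂ : Letter n → Letter n → Filling → Carrier
    F₂ a b T = F ((x , a) ∷ (y , b) ∷ T)

module Mirror (L : ℕ) where
  open import Data.Nat using (_+_)

  mirror : ℕ → ℕ
  mirror x = L ∸ x + 1

  mirror-injective : ∀ {x x'} → x ≤ L → x' ≤ L → mirror x ≡ mirror x' → x ≡ x'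
  mirror-injective {x} {x'} x≤L x'≤L e = ℕₚ.∸-cancelˡ-≡ x≤L x'≤L (ℕₚ.+-cancelʳ-≡ 1 (L ∸ x) (L ∸ x') e)

  mirror-reflects-< : ∀ {x x'} → mirror x < mirror x' → x' < x
  mirror-reflects-< {x} {x'} lt = ℕₚ.∸-cancelʳ-< (ℕₚ.+-cancelʳ-< 1 (L ∸ x) (L ∸ x') lt)

  mirror-antitone-< : ∀ {x x'} → x ≤ L → x' < x → mirror x < mirror x'
  mirror-antitone-< x≤L x'<x = ℕₚ.+-monoˡ-< 1 (ℕₚ.∸-monoʳ-< x'<x x≤L)

  InRange : Box → Set
  InRange (i , j) = i ≤ L × j ≤ L

  ρ : Box → Box
  ρ (i , j) = (mirror j , mirror i)

  ρ-injectiveOn : ∀ {b b'} → InRange b → InRange b' → ρ b ≡ ρ b' → b ≡ b'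
  ρ-injectiveOn (i≤L , j≤L) (i'≤L , j'≤L) e =
    cong₂ _,_ (mirror-injective i≤L i'≤L (cong proj₂ e)) (mirror-injective j≤L j'≤L (cong proj₁ e))

  content-ρ : ∀ {i j} → InRange (i , j) → content (ρ (i , j)) ≡ content (i , j)
  content-ρ {i} {j} (i≤L , j≤L) = begin
    (L ∸ i + 1) ⊖ (L ∸ j + 1)     ≡⟨ cong₂ _⊖_ (ℕₚ.+-comm (L ∸ i) 1) (ℕₚ.+-comm (L ∸ j) 1) ⟩
    (1 + (L ∸ i)) ⊖ (1 + (L ∸ j)) ≡⟨ ℤ.+-cancelˡ-⊖ 1 (L ∸ i) (L ∸ j) ⟩
    (L ∸ i) ⊖ (L ∸ j)             ≡⟨ ℤ.+-cancelˡ-⊖ i (L ∸ i) (L ∸ j) ⟨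
    (i + (L ∸ i)) ⊖ (i + (L ∸ j)) ≡⟨ cong₂ _⊖_ (ℕₚ.m+[n∸m]≡n i≤L) (ℕₚ.+-comm i (L ∸ j)) ⟩
    L ⊖ ((L ∸ j) + i)             ≡⟨ cong (_⊖ ((L ∸ j) + i)) (ℕₚ.m∸n+n≡m j≤L) ⟨
    ((L ∸ j) + j) ⊖ ((L ∸ j) + i) ≡⟨ ℤ.+-cancelˡ-⊖ (L ∸ j) j i ⟩
    j ⊖ i                         ∎
    where open ≡.≡-Reasoning

  Ψ : ∀ {n} → Box × Letter n → Box × Letter n
  Ψ (b , a) = (ρ b , φ a)

  rowOK-Ψ : ∀ {n} (p q : Box × Letter n) → InRange (proj₁ p) → InRange (proj₁ q) →
            RowOK (Ψ p) (Ψ q) ⇔ ColOK q p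
  rowOK-Ψ ((i , j) , a) ((i' , j') , b) (i≤L , j≤L) (i'≤L , j'≤L) = mk⇔ to from
    where
    to : RowOK (Ψ ((i , j) , a)) (Ψ ((i' , j') , b)) → ColOK ((i' , j') , b) ((i , j) , a)
    to row j'≡j i'<i with row (cong mirror (≡.sym j'≡j)) (mirror-antitone-< i≤L i'<i)
    ... | φa≤φb , φa≡φb⇒¬primed =
      φ-reflects-≤ {a = a} {b = b} φa≤φb ,
      λ b≡a unprimed-b → φa≡φb⇒¬primed (cong φ (≡.sym b≡a))
                           (Equivalence.from (primed-φ a) (subst IsUnprimed b≡a unprimed-b))
    from : ColOK ((i' , j') , b) ((i , j) , a) → RowOK (Ψ ((i , j) , a)) (Ψ ((i' , j') , b))
    from col e lt with col (≡.sym (mirror-injective j≤L j'≤L e)) (mirror-reflects-< lt)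
    ... | b≤a , b≡a⇒¬unprimed =
      φ-antitone {a = a} {b = b} b≤a ,
      λ φa≡φb primed-φa → b≡a⇒¬unprimed (≡.sym (φ-injective φa≡φb))
                            (subst IsUnprimed (φ-injective φa≡φb) (Equivalence.to (primed-φ a) primed-φa))

  colOK-Ψ : ∀ {n} (p q : Box × Letter n) → InRange (proj₁ p) → InRange (proj₁ q) →
            ColOK (Ψ p) (Ψ q) ⇔ RowOK q p
  colOK-Ψ ((i , j) , a) ((i' , j') , b) (i≤L , j≤L) (i'≤L , j'≤L) = mk⇔ to from
    where
    to : ColOK (Ψ ((i , j) , a)) (Ψ ((i' , j') , b)) → RowOK ((i' , j') , b) ((i , j) , a)
    to col i'≡i j'<j with col (cong mirror (≡.sym i'≡i)) (mirror-antitone-< j≤L j'<j)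
    ... | φa≤φb , φa≡φb⇒¬unprimed =
      φ-reflects-≤ {a = a} {b = b} φa≤φb ,
      λ b≡a primed-b → φa≡φb⇒¬unprimed (cong φ (≡.sym b≡a))
                         (Equivalence.from (unprimed-φ a) (subst IsPrimed b≡a primed-b))
    from : RowOK ((i' , j') , b) ((i , j) , a) → ColOK (Ψ ((i , j) , a)) (Ψ ((i' , j') , b))
    from row e lt with row (≡.sym (mirror-injective i≤L i'≤L e)) (mirror-reflects-< lt)
    ... | b≤a , b≡a⇒¬primed =
      φ-antitone {a = a} {b = b} b≤a ,
      λ φa≡φb unprimed-φa → b≡a⇒¬primed (≡.sym (φ-injective φa≡φb))
                              (subst IsPrimed (φ-injective φa≡φb) (Equivalence.to (unprimed-φ a) unprimed-φa))

  tableau-Ψ : ∀ {n} {T : List (Box × Letter n)} → All (InRange ∘ proj₁) T →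
              IsTableau T ⇔ IsTableau (map Ψ T)
  tableau-Ψ {T = T} inT = mk⇔ reflected unreflected
    where
    reflected : IsTableau T → IsTableau (map Ψ T)
    reflected tab = All.map⁺ (All.tabulate λ {p} p∈T → All.map⁺ (All.tabulate λ {q} q∈T →
      let ok = All.lookup (All.lookup tab q∈T) p∈T
          inp = All.lookup inT p∈T ; inq = All.lookup inT q∈T
      in Equivalence.from (rowOK-Ψ p q inp inq) (proj₂ ok) , Equivalence.from (colOK-Ψ p q inp inq) (proj₁ ok)))
    unreflected : IsTableau (map Ψ T) → IsTableau T
    unreflected tab = All.tabulate λ {p} p∈T → All.tabulate λ {q} q∈T →
      let ok = All.lookup (All.map⁻ (All.lookup (All.map⁻ tab) q∈T)) p∈T
          inp = All.lookup inT p∈T ; inq = All.lookup inT q∈T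
      in Equivalence.to (colOK-Ψ q p inq inp) (proj₂ ok) , Equivalence.to (rowOK-Ψ q p inq inp) (proj₁ ok)

module SkewDiagrams where
  open import Data.Nat using (_+_)

  private
    square : ℕ → List Box
    square B = concatMap (λ i → map (λ j → (i , j)) (applyUpTo suc B)) (applyUpTo suc B)

    pairs≡cartesianProduct : ∀ (xs ys : List ℕ) →
      concatMap (λ i → map (λ j → (i , j)) ys) xs ≡ cartesianProduct xs ys
    pairs≡cartesianProduct []       ys = ≡.refl
    pairs≡cartesianProduct (x ∷ xs) ys = cong (map (x ,_) ys ++_) (pairs≡cartesianProduct xs ys)

    ∈-square : ∀ {B i j} → 1 ≤ i → i ≤ B → 1 ≤ j → j ≤ B → (i , j) ∈ square B
    ∈-square {B} {suc i} {suc j} _ i≤B _ j≤B =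
      subst ((suc i , suc j) ∈_) (≡.sym (pairs≡cartesianProduct range range))
        (∈-cartesianProduct⁺ (∈-applyUpTo⁺ suc i≤B) (∈-applyUpTo⁺ suc j≤B))
      where range = applyUpTo suc B

    square-unique : ∀ B → Unique (square B)
    square-unique B = subst Unique (≡.sym (pairs≡cartesianProduct range range))
                        (Unique.cartesianProduct⁺ range! range!)
      where
      range = applyUpTo suc B
      range! : Unique range
      range! = Unique.applyUpTo⁺₁ suc B (λ i<j _ e → ℕₚ.<⇒≢ i<j (ℕₚ.suc-injective e))

    part≤sum : ∀ la i → part la i ≤ sum la
    part≤sum []            i             = z≤n
    part≤sum (x ∷ xs)      zero          = z≤n
    part≤sum (x ∷ xs)      (suc zero)    = ℕₚ.m≤m+n x (sum xs)
    part≤sum (x ∷ xs)      (suc (suc i)) = ℕₚ.≤-trans (part≤sum xs (suc i)) (ℕₚ.m≤n+m (sum xs) x)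

  ∈-skewBoxes : ∀ la mu {i j} → (i , j) ∈ skewBoxes la mu ⇔ InSkew la mu i j
  ∈-skewBoxes la mu {i} {j} = mk⇔
    (λ b∈ → proj₂ (∈-filter⁻ inSkew?′ {xs = square B} b∈))
    (λ {skew@((1≤i , i≤ℓ , i≤j , j<λᵢ+i) , _) →
      ∈-filter⁺ inSkew?′ (∈-square 1≤i (ℕₚ.≤-trans i≤ℓ (ℕₚ.m≤m+n _ _)) (ℕₚ.≤-trans 1≤i i≤j) (j≤B j<λᵢ+i i≤ℓ)) skew})
    where
    B = length la + sum la
    inSkew?′ : ∀ b → Dec (InSkew la mu (proj₁ b) (proj₂ b))
    inSkew?′ b = inSkew? la mu (proj₁ b) (proj₂ b)
    -- j < λ_i + i ≤ |λ| + ℓ(λ)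
    j≤B : j < part la i + i → i ≤ length la → j ≤ B
    j≤B j< i≤ℓ = ℕₚ.<⇒≤ (ℕₚ.<-≤-trans j< (ℕₚ.≤-trans (ℕₚ.+-mono-≤ (part≤sum la i) i≤ℓ)
                                                      (ℕₚ.≤-reflexive (ℕₚ.+-comm (sum la) (length la)))))

  skewBoxes-unique : ∀ la mu → Unique (skewBoxes la mu)
  skewBoxes-unique la mu = Unique.filter⁺ _ (square-unique (length la + sum la))

  part+index≤ : ∀ {la} → Linked _>_ la → ∀ i → 1 ≤ i → i ≤ length la → part la i + i ≤ suc (firstPart la)
  part+index≤ {x ∷ xs}     _           (suc zero)    _ _         = ℕₚ.≤-reflexive (ℕₚ.+-comm x 1)
  part+index≤ {x ∷ y ∷ ys} (x>y ∷ dec) (suc (suc k)) _ (s≤s i≤ℓ) =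
    ℕₚ.≤-trans (ℕₚ.≤-reflexive (ℕₚ.+-suc (part (y ∷ ys) (suc k)) (suc k)))
               (s≤s (ℕₚ.≤-trans (part+index≤ dec (suc k) (s≤s z≤n) i≤ℓ) x>y))

  InSF⇒InRange : ∀ {la i j} → Linked _>_ la → InSF la i j → Mirror.InRange (firstPart la) (i , j)
  InSF⇒InRange {la} {i} dec (1≤i , i≤ℓ , i≤j , j<λᵢ+i) = ℕₚ.≤-trans i≤j j≤λ₁ , j≤λ₁
    where j≤λ₁ = ℕₚ.≤-pred (ℕₚ.≤-trans j<λᵢ+i (part+index≤ dec i 1≤i i≤ℓ))

  skewBoxes-inRange : ∀ {la} mu → Linked _>_ la → All (Mirror.InRange (firstPart la)) (skewBoxes la mu)
  skewBoxes-inRange {la} mu dec =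
    All.tabulate λ {(i , j)} b∈ → InSF⇒InRange dec (proj₁ (Equivalence.to (∈-skewBoxes la mu) b∈))

  reflect-skewBoxes : ∀ la mu ka nu → Linked _>_ la →
    (∀ i j → InSkew ka nu i j ⇔ InReflImage la mu i j) →
    map (reflect la) (skewBoxes la mu) ↭ skewBoxes ka nu
  reflect-skewBoxes la mu ka nu dec κ/ν≡ρ[λ/μ] =
    Unique-sameMembers⇒↭
      (Unique-map-injectiveOn (skewBoxes-inRange mu dec) ρ-injectiveOn (skewBoxes-unique la mu))
      (skewBoxes-unique ka nu) image⊆ ⊆image
    where
    open Mirror (firstPart la) using (ρ; ρ-injectiveOn)
    image⊆ : ∀ {b} → b ∈ map ρ (skewBoxes la mu) → b ∈ skewBoxes ka nu
    image⊆ {i , j} b∈ with ∈-map⁻ ρ b∈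
    ... | (i' , j') , b'∈ , e = Equivalence.from (∈-skewBoxes ka nu)
            (Equivalence.from (κ/ν≡ρ[λ/μ] i j) (i' , j' , Equivalence.to (∈-skewBoxes la mu) b'∈ , ≡.sym e))
    ⊆image : ∀ {b} → b ∈ skewBoxes ka nu → b ∈ map ρ (skewBoxes la mu)
    ⊆image {i , j} b∈ with Equivalence.to (κ/ν≡ρ[λ/μ] i j) (Equivalence.to (∈-skewBoxes ka nu) b∈)
    ... | i' , j' , skew , e = subst (_∈ map ρ (skewBoxes la mu)) e
                                 (∈-map⁺ ρ (Equivalence.from (∈-skewBoxes la mu) skew))

-- Being a tableau is a condition on all pairs of filled boxes, so it does
-- not depend on the order in which the filling is listed.
IsTableau-resp-↭ : ∀ {n} {T T' : List (Box × Letter n)} → T ↭ T' → IsTableau T → IsTableau T'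
IsTableau-resp-↭ T↭T' tab = Perm.All-resp-↭ T↭T' (All.map (Perm.All-resp-↭ T↭T') tab)

module QSums {c ℓ : Level} (R : CommutativeSemiring c ℓ) (n : ℕ) where
  open CommutativeSemiring R
  open ListSums R
  open WordSums R n

  Indeterminates : Set c
  Indeterminates = Fin n → ℤ → Carrier

  weight : Indeterminates → Indeterminates → Filling → Carrier
  weight U V T = foldr _*_ 1# (map (wgt R U V) T)

  summand : Indeterminates → Indeterminates → Filling → Carrier
  summand U V T = indicator (isTableau? T) (weight U V T)

  Q-as-ΣFillings : ∀ la mu U V → Q R n la mu U V ≈ ΣFillings (summand U V) (skewBoxes la mu)
  Q-as-ΣFillings la mu U V =
    trans (Σ-filter isTableau? (map (zip bs) fillings) (weight U V))
          (Σ-map fillings (zip bs) (λ T → summand U V T))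
    where
    bs = skewBoxes la mu
    fillings = words n (length bs)

  -- Both the tableau condition and the product of weights ignore order.
  summand-↭ : ∀ U V → PermutationInvariant (summand U V)
  summand-↭ U V {T} {T'} T↭T' =
    indicator-cong (isTableau? T) (isTableau? T')
      (mk⇔ (IsTableau-resp-↭ T↭T') (IsTableau-resp-↭ (Perm.↭-sym T↭T')))
      (PermSetoid.foldr-commMonoid setoid *-isCommutativeMonoid (↭⇒↭ₛ′ isEquivalence (Perm.map⁺ (wgt R U V) T↭T')))

  module Reflected (L : ℕ) (X Y : Indeterminates) where
    open Mirror L

    X̃ Ỹ : Indeterminates
    X̃ = reverseRows X
    Ỹ = reverseRows Y

    -- An unprimed k at content c has weight x_{k,c}; its image (n+1-k)'
    -- has weight x̃_{n+1-k,c} = x_{k,c} at the same content, and likewise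
    -- for primed letters and y.
    wgt-Ψ : ∀ p → InRange (proj₁ p) → wgt R Ỹ X̃ (Ψ p) ≡ wgt R X Y p
    wgt-Ψ ((i , j) , primed k)   inp rewrite opposite-involutive k | content-ρ inp = ≡.refl
    wgt-Ψ ((i , j) , unprimed k) inp rewrite opposite-involutive k | content-ρ inp = ≡.refl

    weight-Ψ : ∀ {T} → All (InRange ∘ proj₁) T → weight Ỹ X̃ (map Ψ T) ≡ weight X Y T
    weight-Ψ []                = ≡.refl
    weight-Ψ (_∷_ {p} inp inT) = cong₂ _*_ (wgt-Ψ p inp) (weight-Ψ inT)

    summand-Ψ : ∀ {T} → All (InRange ∘ proj₁) T → summand X Y T ≈ summand Ỹ X̃ (map Ψ T)
    summand-Ψ {T} inT = indicator-cong (isTableau? T) (isTableau? (map Ψ T))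
      (tableau-Ψ inT) (reflexive (≡.sym (weight-Ψ inT)))

    zip-Ψ : ∀ bs (w : List (Letter n)) → zip (map ρ bs) (map φ w) ≡ map Ψ (zip bs w)
    zip-Ψ []       w       = ≡.refl
    zip-Ψ (b ∷ bs) []      = ≡.refl
    zip-Ψ (b ∷ bs) (a ∷ w) = cong (_ ∷_) (zip-Ψ bs w)

    zip-inRange : ∀ {bs} → All InRange bs → ∀ (w : List (Letter n)) → All (InRange ∘ proj₁) (zip bs w)
    zip-inRange []           w       = []
    zip-inRange (_ ∷ _)      []      = []
    zip-inRange (inb ∷ inbs) (a ∷ w) = inb ∷ zip-inRange inbs w

    ΣFillings-reflect : ∀ {bs} → All InRange bs →
      ΣFillings (summand X Y) bs ≈ ΣFillings (summand Ỹ X̃) (map ρ bs)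
    ΣFillings-reflect {bs} inbs = begin
      Σ (words n m) (λ w → summand X Y (zip bs w))
        ≈⟨ Σ-cong (words n m) (λ w → trans (summand-Ψ (zip-inRange inbs w))
                                           (reflexive (cong (summand Ỹ X̃) (≡.sym (zip-Ψ bs w))))) ⟩
      Σ (words n m) (λ w → summand Ỹ X̃ (zip (map ρ bs) (map φ w)))
        ≈⟨ Σ-words-map φ (φ-↭ n) m (λ w → summand Ỹ X̃ (zip (map ρ bs) w)) ⟩
      Σ (words n m) (λ w → summand Ỹ X̃ (zip (map ρ bs) w))
        ≡⟨ cong (λ m → Σ (words n m) (λ w → summand Ỹ X̃ (zip (map ρ bs) w))) (≡.sym (length-map ρ bs)) ⟩
      ΣFillings (summand Ỹ X̃) (map ρ bs) ∎
      where
      open import Relation.Binary.Reasoning.Setoid setoid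
      m = length bs

lemma1 : ∀ {c ℓ} (R : CommutativeSemiring c ℓ) (n : ℕ) (la mu ka nu : List ℕ) →
         StrictPartition la → StrictPartition mu →
         StrictPartition ka → StrictPartition nu →
         mu ⊆ₚ la →
         (∀ i j → InSkew ka nu i j ⇔ InReflImage la mu i j) →
         (X Y : Fin n → ℤ → CommutativeSemiring.Carrier R) →
         CommutativeSemiring._≈_ R (Q R n la mu X Y)
           (Q R n ka nu (reverseRows Y) (reverseRows X))
lemma1 R n la mu ka nu (la-decreasing , _) _ _ _ _ κ/ν≡ρ[λ/μ] X Y = begin
  Q R n la mu X Y                                  ≈⟨ Q-as-ΣFillings la mu X Y ⟩
  ΣFillings (summand X Y) (skewBoxes la mu)        ≈⟨ ΣFillings-reflect (SkewDiagrams.skewBoxes-inRange mu la-decreasing) ⟩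
  ΣFillings (summand Ỹ X̃) (map (reflect la) (skewBoxes la mu))
    ≈⟨ ΣFillings-↭ (SkewDiagrams.reflect-skewBoxes la mu ka nu la-decreasing κ/ν≡ρ[λ/μ]) (summand Ỹ X̃) (summand-↭ Ỹ X̃) ⟩
  ΣFillings (summand Ỹ X̃) (skewBoxes ka nu)        ≈⟨ Q-as-ΣFillings ka nu Ỹ X̃ ⟨
  Q R n ka nu Ỹ X̃                                  ∎
  where
  open CommutativeSemiring R using (setoid)
  open import Relation.Binary.Reasoning.Setoid setoid
  open WordSums R n using (ΣFillings; ΣFillings-↭)
  open QSums R n
  open Reflected (firstPart la) X Y
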